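{- Let $G(V,E)$ be a graph and let $w$ be a permutational $1$-$11$-representation of $G$ that contains a cube $XXX$ with $X\in V^{+}$. Then there exists a cube-free permutational $1$-$11$-representation of $G$.
   Context: For a word $w$ and letters $x,y$, $w_{\{x,y\}}$ denotes the word obtained from $w$ by deleting all letters other than $x$ and $y$. A word $w\in V^{+}$ is a $1$-$11$-representation of a graph $G(V,E)$ if for all distinct $x,y\in V$: $x,y$ are adjacent in $G$ iff $w_{\{x,y\}}$ contains at most one factor of the form $xx$ or $yy$ in total (equivalently, non-adjacent iff $w_{\{x,y\}}$ contains at least two occurrences of $xx$, or at least two of $yy$, or at least one of each). A $1$-$11$-representation is permutational if it is a concatenation of permutations of $V$ (words in which each vertex of $V$ occurs exactly once). A word contains a cube if it can be written as $s_1XXXs_2$ with $s_1,s_2$ possibly empty and $X$ nonempty; it is cube-free otherwise. -}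

module Defs where

open import Data.Nat using (ℕ; zero; suc; _+_; _≤_)
open import Data.Fin using (Fin)
open import Data.Fin.Properties using (_≟_)
open import Data.List using (List; []; _∷_; _++_; filter; concat; allFin)
open import Data.List.Relation.Binary.Permutation.Propositional using (_↭_)
open import Data.List.Relation.Unary.All using (All)
open import Data.Product using (Σ; _×_; ∃; ∃-syntax)
open import Data.Sum using (_⊎_)
open import Relation.Nullary using (¬_; does)
open import Data.Bool using (if_then_else_; _∧_)
open import Relation.Nullary.Decidable using (_⊎-dec_)
open import Relation.Binary.PropositionalEquality using (_≡_; _≢_)
open import Function.Bundles using (_⇔_)

record Graph (n : ℕ) : Set₁ where
  field
    Adj     : Fin n → Fin n → Set
    sym     : ∀ {x y} → Adj x y → Adj y x
    irrefl  : ∀ {x} → ¬ Adj x x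

restrict : {n : ℕ} → Fin n → Fin n → List (Fin n) → List (Fin n)
restrict x y = filter (λ z → (z ≟ x) ⊎-dec (z ≟ y))

-- Number of occurrences of the factor xx in a word (occurrences may overlap).
countXX : {n : ℕ} → Fin n → List (Fin n) → ℕ
countXX x [] = 0
countXX x (a ∷ w) = go a w
  where
  go : _ → List _ → ℕ
  go a [] = 0
  go a (b ∷ w) = (if does (a ≟ x) ∧ does (b ≟ x) then 1 else 0) + go b w

Is1-11-Rep : {n : ℕ} → Graph n → List (Fin n) → Set
Is1-11-Rep {n} G w =
  (w ≢ []) ×
  (∀ (x y : Fin n) → x ≢ y →
     Graph.Adj G x y ⇔ (countXX x (restrict x y w) + countXX y (restrict x y w) ≤ 1))

IsPermutation : {n : ℕ} → List (Fin n) → Set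
IsPermutation {n} p = p ↭ allFin n

IsPermutational : {n : ℕ} → List (Fin n) → Set
IsPermutational {n} w = Σ (List (List (Fin n))) λ ps → All IsPermutation ps × (w ≡ concat ps)

ContainsCube : {n : ℕ} → List (Fin n) → Set
ContainsCube {n} w = ∃[ s₁ ] ∃[ X ] ∃[ s₂ ] (X ≢ []) × (w ≡ s₁ ++ X ++ X ++ X ++ s₂)

CubeFree : {n : ℕ} → List (Fin n) → Set
CubeFree w = ¬ ContainsCube w

-- In a concatenation of permutations of V every prefix contains each letter K or K + 1 times for
-- a single K, so in any factor the numbers of occurrences of two letters differ by at most 2. In a
-- cube XXX this forces all letters to occur equally often in X, hence |X| is a multiple of |V|, and
-- deleting one X amounts to deleting a factor that starts and ends at block boundaries; the result
-- is again permutational. For letters x ≠ y, the word w_{x,y} read as a binary word contains the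
-- image Y of X, with as many x's as y's: either Y alternates, and then YYY and YY have the same
-- number of factors xx or yy, or Y already has one and both YYY and YY have at least two. So the
-- deletion preserves the representation, and iterating it on the length ends in a cube-free word.
module Submission where

open import Defs

open import Level using (Level)
open import Data.Bool using (Bool; true; false; if_then_else_; _∧_)
import Data.Bool.Properties as Bool
open import Data.Empty using (⊥-elim)
open import Data.Fin using (Fin; zero; suc)
import Data.Fin.Properties as Fin
open import Data.List using (List; []; _∷_; _++_; map; length; concat; tabulate; take; drop)
open import Data.List.Properties
  using ( ≡-dec; ∷-injective; ++-assoc; ++-conicalˡ; ++-conicalʳ; map-++; filter-++; concat-++
        ; length-++; length-++-comm; length-++-≤ˡ; length-++-≤ʳ; length-tabulate )
open import Data.List.Relation.Binary.Permutation.Propositional using (_↭_)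
open import Data.List.Relation.Binary.Permutation.Propositional.Properties using (map⁺; ↭-length)
open import Data.List.Relation.Unary.All using (All; []; _∷_)
import Data.List.Relation.Unary.All.Properties as AllP
open import Data.Nat using (ℕ; zero; suc; _+_; _*_; _≤_; _<_; z≤n; s≤s; s≤s⁻¹)
open import Data.Nat.ListAction using (sum)
open import Data.Nat.ListAction.Properties using (sum-++; sum-↭)
open import Data.Nat.Properties
  using ( ≤-refl; ≤-trans; ≤-reflexive; ≤-antisym; ≤-total; <-≤-trans; module ≤-Reasoning
        ; +-assoc; +-suc; +-identityʳ; +-cancelˡ-≡; +-cancelˡ-≤; +-monoʳ-≤; +-monoˡ-≤; +-monoʳ-<
        ; m≤m+n; m≤n+m; m<n+m; suc-injective; *-comm; *-suc; *-identityˡ; *-cancelˡ-<; anyUpTo?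
        ; +-0-commutativeMonoid; +-commutativeSemigroup )
open import Algebra.Properties.CommutativeMonoid.Sum +-0-commutativeMonoid
  using (sum-syntax; ∑-distrib-+; sum-cong-≗; sum-replicate-zero)
open import Algebra.Properties.CommutativeSemigroup +-commutativeSemigroup
  using (interchange)
import Data.Product as Product
open import Data.Product using (Σ; ∃; ∃-syntax; _×_; _,_; proj₁; proj₂)
open import Data.Sum using (_⊎_; inj₁; inj₂)
open import Function using (_∘_; id; _⇔_; mk⇔)
open import Function.Construct.Composition using (_⇔-∘_)
open import Function.Construct.Identity using (⇔-id)
open import Relation.Binary.Definitions using (DecidableEquality)
open import Relation.Binary.PropositionalEquality
  using (_≡_; _≢_; refl; sym; trans; cong; cong₂; subst; subst₂; module ≡-Reasoning)
open import Relation.Nullary using (¬_; Dec; does; yes; no; contradiction; ¬?)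
open import Relation.Nullary.Decidable using (_⊎-dec_; _×-dec_; map′; dec-true; dec-false)
open import Relation.Unary using (Decidable)

private variable a : Level

prefix-of-shorter : {A : Set a} (u v x y : List A) → u ++ v ≡ x ++ y → length u ≤ length x →
                    ∃[ z ] x ≡ u ++ z × v ≡ z ++ y
prefix-of-shorter [] v x y eq _ = x , refl , eq
prefix-of-shorter (c ∷ u) v (d ∷ x) y eq (s≤s u≤x) with ∷-injective eq
... | refl , eq′ with prefix-of-shorter u v x y eq′ u≤x
...   | z , x≡uz , v≡zy = z , cong (c ∷_) x≡uz , v≡zy

take-length-++ : {A : Set a} (u v : List A) → take (length u) (u ++ v) ≡ u
take-length-++ []      v = refl
take-length-++ (c ∷ u) v = cong (c ∷_) (take-length-++ u v)

drop-length-++ : {A : Set a} (u v : List A) → drop (length u) (u ++ v) ≡ v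
drop-length-++ []      v = refl
drop-length-++ (c ∷ u) v = drop-length-++ u v

length-<-insert : {A : Set a} (u X v : List A) → X ≢ [] → length (u ++ v) < length (u ++ X ++ v)
length-<-insert u []      v X≢[] = contradiction refl X≢[]
length-<-insert u (c ∷ X) v _    =
  subst₂ _<_ (sym (length-++ u)) (sym (trans (length-++ u) (cong (length u +_) (length-++ (c ∷ X)))))
  (+-monoʳ-< (length u) (m<n+m (length v) {suc (length X)} (s≤s z≤n)))

thrice-≤ : ∀ p q → 3 * p ≤ 2 + 3 * q → p ≤ q
thrice-≤ p q h = s≤s⁻¹ (*-cancelˡ-< 3 p (suc q) (≤-trans (s≤s h) (≤-reflexive (sym (*-suc 3 q)))))

module WordStatistics {A : Set a} (_≟_ : DecidableEquality A) where

  δ : A → A → ℕ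
  δ b c = if does (b ≟ c) then 1 else 0

  count : A → List A → ℕ
  count c = sum ∘ map (λ b → δ b c)

  count-++ : ∀ c u v → count c (u ++ v) ≡ count c u + count c v
  count-++ c u v = trans (cong sum (map-++ _ u v)) (sum-++ (map _ u) (map _ v))

  count-↭ : ∀ c {u v} → u ↭ v → count c u ≡ count c v
  count-↭ c u↭v = sum-↭ (map⁺ _ u↭v)

  repeats : List A → ℕ
  repeats []          = 0
  repeats (b ∷ [])    = 0
  repeats (b ∷ c ∷ u) = δ b c + repeats (c ∷ u)

  repeats-++-≥ : ∀ u v → repeats u + repeats v ≤ repeats (u ++ v)
  repeats-++-≥ []          v       = ≤-refl
  repeats-++-≥ (b ∷ [])    []      = z≤n
  repeats-++-≥ (b ∷ [])    (c ∷ v) = m≤n+m _ _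
  repeats-++-≥ (b ∷ c ∷ u) v       =
    ≤-trans (≤-reflexive (+-assoc (δ b c) _ _)) (+-monoʳ-≤ (δ b c) (repeats-++-≥ (c ∷ u) v))

  repeats-++-cong : ∀ u b v v′ → repeats (b ∷ v) ≡ repeats (b ∷ v′) →
                    repeats (u ++ b ∷ v) ≡ repeats (u ++ b ∷ v′)
  repeats-++-cong []          b v v′ eq = eq
  repeats-++-cong (c ∷ [])    b v v′ eq = cong (δ c b +_) eq
  repeats-++-cong (c ∷ d ∷ u) b v v′ eq = cong (δ c d +_) (repeats-++-cong (d ∷ u) b v v′ eq)

  repeats-square-≥ : ∀ s u t → repeats u + repeats u ≤ repeats (s ++ u ++ u ++ t)
  repeats-square-≥ s u t = begin
    repeats u + repeats u               ≤⟨ +-monoʳ-≤ (repeats u) (m≤m+n (repeats u) (repeats t)) ⟩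
    repeats u + (repeats u + repeats t) ≤⟨ +-monoʳ-≤ (repeats u) (repeats-++-≥ u t) ⟩
    repeats u + repeats (u ++ t)        ≤⟨ repeats-++-≥ u (u ++ t) ⟩
    repeats (u ++ u ++ t)               ≤⟨ m≤n+m _ (repeats s) ⟩
    repeats s + repeats (u ++ u ++ t)   ≤⟨ repeats-++-≥ s (u ++ u ++ t) ⟩
    repeats (s ++ u ++ u ++ t)          ∎
    where open ≤-Reasoning

open WordStatistics Bool._≟_ using (repeats; repeats-++-cong; repeats-square-≥)
  renaming (count to count𝔹; δ to δ𝔹)

alternating-balanced : ∀ b u v → repeats (b ∷ u) ≡ 0 → count𝔹 true (b ∷ u) ≡ count𝔹 false (b ∷ u) →
                       repeats ((b ∷ u) ++ b ∷ v) ≡ repeats (b ∷ v)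
alternating-balanced true  []                  v _  ()
alternating-balanced false []                  v _  ()
alternating-balanced true  (true ∷ u)          v () _
alternating-balanced false (false ∷ u)         v () _
alternating-balanced true  (false ∷ [])        v _  _   = refl
alternating-balanced false (true ∷ [])         v _  _   = refl
alternating-balanced true  (false ∷ false ∷ u) v () _
alternating-balanced false (true ∷ true ∷ u)   v () _
alternating-balanced true  (false ∷ true ∷ u)  v r₀ bal =
  alternating-balanced true u v r₀ (suc-injective bal)
alternating-balanced false (true ∷ false ∷ u)  v r₀ bal =
  alternating-balanced false u v r₀ (suc-injective bal)

balanced-cube⇔square : ∀ s u t → count𝔹 true u ≡ count𝔹 false u →
                       (repeats (s ++ u ++ u ++ u ++ t) ≤ 1) ⇔ (repeats (s ++ u ++ u ++ t) ≤ 1)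
balanced-cube⇔square s []      t _ = ⇔-id _
balanced-cube⇔square s (b ∷ u) t bal with repeats (b ∷ u) in repeats≡
... | zero  = mk⇔ (subst (_≤ 1) same) (subst (_≤ 1) (sym same))
  where
  same : repeats (s ++ (b ∷ u) ++ (b ∷ u) ++ (b ∷ u) ++ t) ≡ repeats (s ++ (b ∷ u) ++ (b ∷ u) ++ t)
  same = repeats-++-cong s b _ _ (alternating-balanced b u (u ++ (b ∷ u) ++ t) repeats≡ bal)
... | suc k = mk⇔ (⊥-elim ∘ too-many ((b ∷ u) ++ t)) (⊥-elim ∘ too-many t)
  where
  too-many : ∀ v → ¬ repeats (s ++ (b ∷ u) ++ (b ∷ u) ++ v) ≤ 1
  too-many v h with ≤-trans two≤ (≤-trans squares h)
    where
    squares : suc k + suc k ≤ repeats (s ++ (b ∷ u) ++ (b ∷ u) ++ v)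
    squares = subst (λ m → m + m ≤ repeats (s ++ (b ∷ u) ++ (b ∷ u) ++ v)) repeats≡
                    (repeats-square-≥ s (b ∷ u) v)
    two≤ : 2 ≤ suc k + suc k
    two≤ = s≤s (≤-trans (s≤s z≤n) (m≤n+m (suc k) k))
  ... | s≤s ()

open module Letters {n : ℕ} = WordStatistics (Fin._≟_ {n}) using (δ; count; count-++; count-↭)

∑-const : ∀ m k → ∑[ i < m ] k ≡ m * k
∑-const zero    k = refl
∑-const (suc m) k = cong (k +_) (∑-const m k)

∑-δ-row : ∀ {n} (b : Fin n) → ∑[ c < n ] δ b c ≡ 1
∑-δ-row {suc n} zero    = cong suc (sum-replicate-zero n)
∑-δ-row {suc n} (suc b) = ∑-δ-row b

∑-δ-column : ∀ {n} (c : Fin n) → ∑[ b < n ] δ b c ≡ 1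
∑-δ-column {suc n} zero    = cong suc (sum-replicate-zero n)
∑-δ-column {suc n} (suc c) = ∑-δ-column c

count-tabulate : ∀ {m n} (f : Fin m → Fin n) c → count c (tabulate f) ≡ ∑[ i < m ] δ (f i) c
count-tabulate {zero}  f c = refl
count-tabulate {suc m} f c = cong (δ (f zero) c +_) (count-tabulate (f ∘ suc) c)

length≡∑count : ∀ {n} (v : List (Fin n)) → length v ≡ ∑[ c < n ] count c v
length≡∑count {n} []      = sym (sum-replicate-zero n)
length≡∑count {n} (b ∷ v) = sym (begin
  ∑[ c < n ] (δ b c + count c v)              ≡⟨ ∑-distrib-+ (δ b) (λ c → count c v) ⟩
  ∑[ c < n ] δ b c + ∑[ c < n ] count c v     ≡⟨ cong₂ _+_ (∑-δ-row b) (sym (length≡∑count v)) ⟩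
  suc (length v)                              ∎)
  where open ≡-Reasoning

length-uniform : ∀ {n} (v : List (Fin n)) k → (∀ c → count c v ≡ k) → length v ≡ n * k
length-uniform {n} v k uniform = trans (length≡∑count v) (trans (sum-cong-≗ uniform) (∑-const n k))

module _ {n : ℕ} {p : List (Fin n)} (p↭ : IsPermutation p) where

  count-permutation : ∀ c → count c p ≡ 1
  count-permutation c = trans (count-↭ c p↭) (trans (count-tabulate id c) (∑-δ-column c))

  length-permutation : length p ≡ n
  length-permutation = trans (↭-length p↭) (length-tabulate id)

module _ {n : ℕ} where

  prefix-balanced : ∀ ps → All IsPermutation ps → ∀ (u v : List (Fin n)) → u ++ v ≡ concat ps →
                    ∃[ K ] ∀ c → K ≤ count c u × count c u ≤ suc K
  prefix-balanced []       []          []      v eq = 0 , λ _ → z≤n , z≤n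
  prefix-balanced (p ∷ ps) (p↭ ∷ ps↭) u v eq with ≤-total (length u) (length p)
  ... | inj₁ u≤p with prefix-of-shorter u v p (concat ps) eq u≤p
  ...   | z , p≡uz , _ = 0 , λ c → z≤n , (begin
    count c u             ≤⟨ m≤m+n _ _ ⟩
    count c u + count c z ≡⟨ sym (count-++ c u z) ⟩
    count c (u ++ z)      ≡⟨ cong (count c) p≡uz ⟨
    count c p             ≡⟨ count-permutation p↭ c ⟩
    1                     ∎)
    where open ≤-Reasoning
  prefix-balanced (p ∷ ps) (p↭ ∷ ps↭) u v eq | inj₂ p≤u
    with prefix-of-shorter p (concat ps) u v (sym eq) p≤u
  ... | z , u≡pz , ps≡zv with prefix-balanced ps ps↭ z v (sym ps≡zv)
  ...   | K , bounds = suc K , λ c →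
    subst (λ m → suc K ≤ m × m ≤ suc (suc K)) (sym (count-u c)) (Product.map s≤s s≤s (bounds c))
    where
    count-u : ∀ c → count c u ≡ suc (count c z)
    count-u c = trans (cong (count c) u≡pz)
                      (trans (count-++ c p z) (cong (_+ count c z) (count-permutation p↭ c)))

  factor-balanced : ∀ ps → All IsPermutation ps → ∀ (s v t : List (Fin n)) → s ++ v ++ t ≡ concat ps →
                    ∀ b c → count b v ≤ 2 + count c v
  factor-balanced ps ps↭ s v t eq b c
    with prefix-balanced ps ps↭ s (v ++ t) eq
       | prefix-balanced ps ps↭ (s ++ v) t (trans (++-assoc s v t) eq)
  ... | K , bounds-s | L , bounds-sv = +-cancelˡ-≤ (count b s) _ _ (begin
    count b s + count b v       ≡⟨ count-++ b s v ⟨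
    count b (s ++ v)            ≤⟨ proj₂ (bounds-sv b) ⟩
    suc L                       ≤⟨ s≤s (proj₁ (bounds-sv c)) ⟩
    suc (count c (s ++ v))      ≡⟨ cong suc (count-++ c s v) ⟩
    suc (count c s + count c v) ≤⟨ s≤s (+-monoˡ-≤ _ (proj₂ (bounds-s c))) ⟩
    suc (suc K + count c v)     ≤⟨ s≤s (s≤s (+-monoˡ-≤ _ (proj₁ (bounds-s b)))) ⟩
    2 + (count b s + count c v) ≡⟨ trans (+-suc _ _) (cong suc (+-suc _ _)) ⟨
    count b s + (2 + count c v) ∎)
    where open ≤-Reasoning

  cube-balanced : ∀ ps → All IsPermutation ps → ∀ (s X t : List (Fin n)) →
                  s ++ X ++ X ++ X ++ t ≡ concat ps → ∀ b c → count b X ≡ count c X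
  cube-balanced ps ps↭ s X t eq b c = ≤-antisym (bound b c) (bound c b)
    where
    eq′ : s ++ (X ++ X ++ X) ++ t ≡ concat ps
    eq′ = trans (cong (s ++_) (trans (++-assoc X (X ++ X) t) (cong (X ++_) (++-assoc X X t)))) eq
    count-cube : ∀ a → count a (X ++ X ++ X) ≡ 3 * count a X
    count-cube a = trans (count-++ a X (X ++ X))
      (cong (count a X +_) (trans (count-++ a X X) (cong (count a X +_) (sym (+-identityʳ _)))))
    bound : ∀ b c → count b X ≤ count c X
    bound b c = thrice-≤ _ _ (subst₂ (λ x y → x ≤ 2 + y) (count-cube b) (count-cube c)
                                     (factor-balanced ps ps↭ s (X ++ X ++ X) t eq′ b c))

  balanced-length : ∀ (X : List (Fin n)) → (∀ b c → count b X ≡ count c X) → ∃[ k ] length X ≡ k * n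
  balanced-length []          _        = 0 , refl
  balanced-length X@(b ∷ _) balanced =
    count b X , trans (length-uniform X (count b X) (λ c → balanced c b)) (*-comm n _)

  ++-permutational : ∀ {u v : List (Fin n)} →
                     IsPermutational u → IsPermutational v → IsPermutational (u ++ v)
  ++-permutational (ps , ps↭ , u≡) (qs , qs↭ , v≡) =
    ps ++ qs , AllP.++⁺ ps↭ qs↭ , trans (cong₂ _++_ u≡ v≡) (concat-++ ps qs)

  split-aligned : ∀ k ps → All IsPermutation ps → ∀ (u v : List (Fin n)) → u ++ v ≡ concat ps →
                  length u ≡ k * n → IsPermutational u × IsPermutational v
  split-aligned zero    ps       ps↭         []      v eq _ = ([] , [] , refl) , (ps , ps↭ , eq)
  split-aligned (suc k) []       []          u       v eq _ =
    ([] , [] , ++-conicalˡ u v eq) , ([] , [] , ++-conicalʳ u v eq)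
  split-aligned (suc k) (p ∷ ps) (p↭ ∷ ps↭) u       v eq |u|
    with prefix-of-shorter p (concat ps) u v (sym eq) p≤u
    where
    p≤u : length p ≤ length u
    p≤u = subst₂ _≤_ (sym (length-permutation p↭)) (sym |u|) (m≤m+n n (k * n))
  ... | z , u≡pz , ps≡zv with split-aligned k ps ps↭ z v (sym ps≡zv) |z|
    where
    |z| : length z ≡ k * n
    |z| = +-cancelˡ-≡ n _ _ (begin
      n + length z        ≡⟨ cong (_+ length z) (length-permutation p↭) ⟨
      length p + length z ≡⟨ length-++ p ⟨
      length (p ++ z)     ≡⟨ cong length u≡pz ⟨
      length u            ≡⟨ |u| ⟩
      n + k * n           ∎)
      where open ≡-Reasoning
  ...   | (qs , qs↭ , z≡) , v-perm = (p ∷ qs , p↭ ∷ qs↭ , trans u≡pz (cong (p ++_) z≡)) , v-perm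

  block-boundary : ∀ ps → All IsPermutation ps → ∀ (u v : List (Fin n)) →
                   u ++ v ≡ concat ps → v ≢ [] →
                   ∃[ x ] ∃[ y ] ∃[ k ] v ≡ x ++ y × length x ≤ n × length (u ++ x) ≡ k * n
  block-boundary []       []          u v eq v≢[] = contradiction (++-conicalʳ u v eq) v≢[]
  block-boundary (p ∷ ps) (p↭ ∷ ps↭) u v eq v≢[] with ≤-total (length u) (length p)
  ... | inj₁ u≤p with prefix-of-shorter u v p (concat ps) eq u≤p
  ...   | z , p≡uz , v≡zps = z , concat ps , 1 , v≡zps , |z|≤n , |uz|≡n
    where
    |uz|≡n : length (u ++ z) ≡ 1 * n
    |uz|≡n = trans (cong length (sym p≡uz)) (trans (length-permutation p↭) (sym (*-identityˡ n)))
    |z|≤n : length z ≤ n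
    |z|≤n = ≤-trans (length-++-≤ʳ z {u}) (≤-reflexive (trans |uz|≡n (*-identityˡ n)))
  block-boundary (p ∷ ps) (p↭ ∷ ps↭) u v eq v≢[] | inj₂ p≤u
    with prefix-of-shorter p (concat ps) u v (sym eq) p≤u
  ... | z , u≡pz , ps≡zv with block-boundary ps ps↭ z v (sym ps≡zv) v≢[]
  ...   | x , y , k , v≡xy , |x|≤n , |zx| = x , y , suc k , v≡xy , |x|≤n , (begin
    length (u ++ x)          ≡⟨ cong (λ w → length (w ++ x)) u≡pz ⟩
    length ((p ++ z) ++ x)   ≡⟨ cong length (++-assoc p z x) ⟩
    length (p ++ z ++ x)     ≡⟨ length-++ p ⟩
    length p + length (z ++ x) ≡⟨ cong₂ _+_ (length-permutation p↭) |zx| ⟩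
    n + k * n                ∎)
    where open ≡-Reasoning

  -- Cutting s X X t at a block boundary inside the first X (X = x z) exhibits the factor z x of
  -- length |X| between two block boundaries; removing it leaves s X t.
  square-reduction : ∀ k (s X t : List (Fin n)) → length X ≡ k * n →
                     IsPermutational (s ++ X ++ X ++ t) → IsPermutational (s ++ X ++ t)
  square-reduction _       s []        t _   w-perm = w-perm
  square-reduction zero    s (_ ∷ _)   t ()  _
  square-reduction (suc k) s X@(_ ∷ _) t |X| (ps , ps↭ , w≡)
    with block-boundary ps ps↭ s (X ++ X ++ t) w≡ (λ ())
  ... | x , y , j , XXt≡xy , |x|≤n , |sx|
    with prefix-of-shorter x y X (X ++ t) (sym XXt≡xy) (≤-trans |x|≤n n≤|X|)
    where
    n≤|X| : n ≤ length X
    n≤|X| = subst (n ≤_) (sym |X|) (m≤m+n n (k * n))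
  ...   | z , X≡xz , y≡zXt
    with split-aligned j ps ps↭ (s ++ x) ((z ++ x) ++ z ++ t) (trans (sym split-at-x) w≡) |sx|
    where
    split-at-x : s ++ X ++ X ++ t ≡ (s ++ x) ++ (z ++ x) ++ z ++ t
    split-at-x = begin
      s ++ X ++ X ++ t               ≡⟨ cong (s ++_) XXt≡xy ⟩
      s ++ x ++ y                    ≡⟨ cong (λ w → s ++ x ++ w) y≡zXt ⟩
      s ++ x ++ z ++ X ++ t          ≡⟨ cong (λ w → s ++ x ++ z ++ w ++ t) X≡xz ⟩
      s ++ x ++ z ++ (x ++ z) ++ t   ≡⟨ cong (λ w → s ++ x ++ z ++ w) (++-assoc x z t) ⟩
      s ++ x ++ z ++ x ++ z ++ t     ≡⟨ cong (λ w → s ++ x ++ w) (++-assoc z x (z ++ t)) ⟨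
      s ++ x ++ (z ++ x) ++ z ++ t   ≡⟨ ++-assoc s x _ ⟨
      (s ++ x) ++ (z ++ x) ++ z ++ t ∎
      where open ≡-Reasoning
  ...     | sx-perm , (qs , qs↭ , rest≡)
    with split-aligned (suc k) qs qs↭ (z ++ x) (z ++ t) rest≡ |zx|
    where
    |zx| : length (z ++ x) ≡ suc k * n
    |zx| = trans (length-++-comm z x) (trans (cong length (sym X≡xz)) |X|)
  ...       | _ , zt-perm = subst IsPermutational (sym sXt≡) (++-permutational sx-perm zt-perm)
    where
    sXt≡ : s ++ X ++ t ≡ (s ++ x) ++ z ++ t
    sXt≡ = trans (cong (λ w → s ++ w ++ t) X≡xz)
                 (trans (cong (s ++_) (++-assoc x z t)) (sym (++-assoc s x _)))

module _ {n : ℕ} (x y : Fin n) where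

  InPair : Fin n → Set
  InPair z = z ≡ x ⊎ z ≡ y

  inPair? : Decidable InPair
  inPair? z = (z Fin.≟ x) ⊎-dec (z Fin.≟ y)

  isX : Fin n → Bool
  isX z = does (z Fin.≟ x)

  -- w_{x,y} as a binary word, x ↦ true and y ↦ false
  binary : List (Fin n) → List Bool
  binary = map isX ∘ restrict x y

  binary-++ : ∀ u v → binary (u ++ v) ≡ binary u ++ binary v
  binary-++ u v =
    trans (cong (map isX) (filter-++ inPair? u v)) (map-++ isX (restrict x y u) (restrict x y v))

  binary-square : ∀ s u t → binary (s ++ u ++ u ++ t) ≡ binary s ++ binary u ++ binary u ++ binary t
  binary-square s u t =
    trans (binary-++ s _)
          (cong (binary s ++_) (trans (binary-++ u _) (cong (binary u ++_) (binary-++ u t))))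

  square-at : Fin n → Fin n → Fin n → ℕ
  square-at z a b = if does (a Fin.≟ z) ∧ does (b Fin.≟ z) then 1 else 0

  module _ (x≢y : x ≢ y) where

    count-binary : ∀ v → count𝔹 true (binary v) ≡ count x v × count𝔹 false (binary v) ≡ count y v
    count-binary []      = refl , refl
    count-binary (b ∷ v) with b Fin.≟ x | b Fin.≟ y | count-binary v
    ... | yes b≡x | yes b≡y | _         = contradiction (trans (sym b≡x) b≡y) x≢y
    ... | yes b≡x | no _    | ih₁ , ih₂ rewrite dec-true (b Fin.≟ x) b≡x  = cong suc ih₁ , ih₂
    ... | no b≢x  | yes _   | ih₁ , ih₂ rewrite dec-false (b Fin.≟ x) b≢x = ih₁ , cong suc ih₂
    ... | no _    | no _    | ih        = ih

    pair-squares : ∀ {a b} → InPair a → InPair b →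
                   square-at x a b + square-at y a b ≡ δ𝔹 (isX a) (isX b)
    pair-squares (inj₁ refl) (inj₁ refl)
      rewrite dec-true (x Fin.≟ x) refl | dec-false (x Fin.≟ y) x≢y = refl
    pair-squares (inj₁ refl) (inj₂ refl)
      rewrite dec-true (x Fin.≟ x) refl | dec-false (y Fin.≟ x) (x≢y ∘ sym)
            | dec-false (x Fin.≟ y) x≢y = refl
    pair-squares (inj₂ refl) (inj₁ refl)
      rewrite dec-true (x Fin.≟ x) refl | dec-false (y Fin.≟ x) (x≢y ∘ sym)
            | dec-false (x Fin.≟ y) x≢y | dec-true (y Fin.≟ y) refl = refl
    pair-squares (inj₂ refl) (inj₂ refl)
      rewrite dec-false (y Fin.≟ x) (x≢y ∘ sym) | dec-true (y Fin.≟ y) refl = refl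

    squares≡repeats : ∀ {r} → All InPair r → countXX x r + countXX y r ≡ repeats (map isX r)
    squares≡repeats []                   = refl
    squares≡repeats (_ ∷ [])             = refl
    squares≡repeats {a ∷ b ∷ r} (a∈ ∷ b∈ ∷ r∈) =
      trans (interchange (square-at x a b) (countXX x (b ∷ r)) (square-at y a b) (countXX y (b ∷ r)))
            (cong₂ _+_ (pair-squares a∈ b∈) (squares≡repeats (b∈ ∷ r∈)))

    squares-binary : ∀ v →
                     countXX x (restrict x y v) + countXX y (restrict x y v) ≡ repeats (binary v)
    squares-binary v = squares≡repeats (AllP.all-filter inPair? v)

module _ {n : ℕ} where

  -- w = s X X X t with |s| = i and |X| = ℓ
  CubeAt : List (Fin n) → ℕ → ℕ → Set
  CubeAt w i ℓ = let X = take ℓ (drop i w) in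
    X ≢ [] × w ≡ take i w ++ X ++ X ++ X ++ drop ℓ (drop ℓ (drop ℓ (drop i w)))

  cubeAt? : ∀ w i ℓ → Dec (CubeAt w i ℓ)
  cubeAt? w i ℓ = ¬? (≡-dec Fin._≟_ _ []) ×-dec ≡-dec Fin._≟_ w _

  cubeAt-factorisation : ∀ (s X t : List (Fin n)) → X ≢ [] →
                         CubeAt (s ++ X ++ X ++ X ++ t) (length s) (length X)
  cubeAt-factorisation s X t X≢[]
    rewrite drop-length-++ s (X ++ X ++ X ++ t) | take-length-++ s (X ++ X ++ X ++ t)
          | take-length-++ X (X ++ X ++ t) | drop-length-++ X (X ++ X ++ t)
          | drop-length-++ X (X ++ t) | drop-length-++ X t = X≢[] , refl

  containsCube? : ∀ (w : List (Fin n)) → Dec (ContainsCube w)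
  containsCube? w =
    map′ sound complete (anyUpTo? (λ i → anyUpTo? (cubeAt? w i) (suc (length w))) (suc (length w)))
    where
    sound : (∃ λ i → i < suc (length w) × ∃ λ ℓ → ℓ < suc (length w) × CubeAt w i ℓ) → ContainsCube w
    sound (i , _ , ℓ , _ , X≢[] , w≡) = take i w , take ℓ (drop i w) , _ , X≢[] , w≡
    complete : ContainsCube w → ∃ λ i → i < suc (length w) × ∃ λ ℓ → ℓ < suc (length w) × CubeAt w i ℓ
    complete (s , X , t , X≢[] , refl) =
      length s , s≤s (length-++-≤ˡ s) ,
      length X , s≤s (≤-trans (length-++-≤ˡ X) (length-++-≤ʳ (X ++ X ++ X ++ t) {s})) ,
      cubeAt-factorisation s X t X≢[]

module _ {n : ℕ} (G : Graph n) where
  open Graph G using (Adj)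

  rep-transfer : ∀ {w w′} → w′ ≢ [] →
                 (∀ x y → x ≢ y → (repeats (binary x y w) ≤ 1) ⇔ (repeats (binary x y w′) ≤ 1)) →
                 Is1-11-Rep G w → Is1-11-Rep G w′
  rep-transfer {w} {w′} w′≢[] same (_ , rep) = w′≢[] , λ x y x≢y →
    subst (λ m → Adj x y ⇔ (m ≤ 1)) (sym (squares-binary x y x≢y w′))
      (same x y x≢y ⇔-∘ subst (λ m → Adj x y ⇔ (m ≤ 1)) (squares-binary x y x≢y w) (rep x y x≢y))

  cube-reduction-rep : ∀ (s X t : List (Fin n)) → X ≢ [] → (∀ b c → count b X ≡ count c X) →
                       Is1-11-Rep G (s ++ X ++ X ++ X ++ t) → Is1-11-Rep G (s ++ X ++ X ++ t)
  cube-reduction-rep s X t X≢[] balanced = rep-transfer nonempty λ x y x≢y →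
    subst₂ (λ u v → (repeats u ≤ 1) ⇔ (repeats v ≤ 1))
      (sym (trans (binary-square x y s X (X ++ t))
                  (cong (λ v → binary x y s ++ binary x y X ++ binary x y X ++ v) (binary-++ x y X t))))
      (sym (binary-square x y s X t))
      (balanced-cube⇔square (binary x y s) (binary x y X) (binary x y t)
        (trans (proj₁ (count-binary x y x≢y X))
               (trans (balanced x y) (sym (proj₂ (count-binary x y x≢y X))))))
    where
    nonempty : s ++ X ++ X ++ t ≢ []
    nonempty e = X≢[] (++-conicalˡ X _ (++-conicalʳ s _ e))

  cube-reduction : ∀ (s X t : List (Fin n)) → X ≢ [] →
                   IsPermutational (s ++ X ++ X ++ X ++ t) → Is1-11-Rep G (s ++ X ++ X ++ X ++ t) →
                   IsPermutational (s ++ X ++ X ++ t) × Is1-11-Rep G (s ++ X ++ X ++ t)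
  cube-reduction s X t X≢[] w-perm@(ps , ps↭ , w≡) w-rep =
    square-reduction k s X (X ++ t) |X| w-perm , cube-reduction-rep s X t X≢[] balanced w-rep
    where
    balanced : ∀ b c → count b X ≡ count c X
    balanced = cube-balanced ps ps↭ s X t w≡
    k : ℕ
    k = proj₁ (balanced-length X balanced)
    |X| : length X ≡ k * n
    |X| = proj₂ (balanced-length X balanced)

  cube-free-reduction : ∀ k w → length w < k → IsPermutational w → Is1-11-Rep G w →
                        Σ (List (Fin n)) λ u → IsPermutational u × Is1-11-Rep G u × CubeFree u
  cube-free-reduction (suc k) w |w|≤k w-perm w-rep with containsCube? w
  ... | no cube-free = w , w-perm , w-rep , cube-free
  ... | yes (s , X , t , X≢[] , refl) with cube-reduction s X t X≢[] w-perm w-rep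
  ...   | w′-perm , w′-rep = cube-free-reduction k (s ++ X ++ X ++ t)
          (<-≤-trans (length-<-insert s X (X ++ X ++ t) X≢[]) (s≤s⁻¹ |w|≤k)) w′-perm w′-rep

mainTheorem5 : (n : ℕ) (G : Graph n) (w : List (Fin n)) →
    IsPermutational w → Is1-11-Rep G w → ContainsCube w →
    Σ (List (Fin n)) λ u → IsPermutational u × Is1-11-Rep G u × CubeFree u
mainTheorem5 n G w w-perm w-rep _ = cube-free-reduction G (suc (length w)) w ≤-refl w-perm w-rep
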